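{- Consider an instance of deadline-scheduling-with-processor-bounds with bounds $l_t, m_t$ ($t\in T$) and the flow network with source $\alpha$, sink $\omega$, auxiliary node $\gamma$, nodes $u_j$ ($j\in J$), $v_t$ ($t \in T$) and arcs $\alpha \to u_j$ of capacity $p_j$, $u_j \to v_t$ of capacity $1$ if $t \in E_j$ and $0$ otherwise, $v_t \to \gamma$ of capacity $m_t - l_t$, $v_t \to \omega$ of capacity $l_t$, and $\gamma \to \omega$ of capacity $P - \sum_{t\in T} l_t$. For every $\alpha$-$\omega$ cut $(S,\bar S)$ (with $\alpha \in S$, $\omega \in \bar S$), writing $Q(S) = \{t : v_t \in S\}$ and $Q(\bar S) = \{t : v_t \in \bar S\}$, the capacity $c(S)$ of the cut satisfies at least one of $c(S) \ge P - \mathrm{def}(Q(S))$ or $c(S) \ge P - \mathrm{exc}(Q(\bar S))$.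
   Context: There are $m$ processors and a set $J$ of jobs with integer release times $r_j$, deadlines $d_j$ and processing volumes $p_j$; $P = \sum_j p_j$; time slots $T = \{0,\dots,d\}$; $E_j = \{t\in T : r_j\le t\le d_j\}$. An instance of deadline-scheduling-with-processor-bounds specifies integers $0\le l_t \le m_t \le m$ for $t \in T$. For $Q \subseteq T$ and a job $j$: the forced volume is $\mathrm{fv}(j,Q) = \max\{0, p_j - |E_j \setminus Q|\}$ and the possible volume is $\mathrm{pv}(j,Q) = \min\{p_j, |E_j \cap Q|\}$; $\mathrm{fv}(Q) = \sum_{j\in J}\mathrm{fv}(j,Q)$ and $\mathrm{pv}(Q) = \sum_{j\in J}\mathrm{pv}(j,Q)$. The deficiency is $\mathrm{def}(Q) = \mathrm{fv}(Q) - \sum_{t\in Q} m_t$ and the excess is $\mathrm{exc}(Q) = \sum_{t\in Q} l_t - \mathrm{pv}(Q)$. The capacity of a cut is the total capacity of arcs from $S$ to $\bar S$. -}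

module Defs where

open import Data.Nat as ℕ using (ℕ; _≤_; _≤ᵇ_; _∸_; _⊓_)
open import Data.Integer as ℤ using (ℤ; +_; _-_; _+_)
open import Data.Fin using (Fin; toℕ)
open import Data.List using (List; []; _∷_; map; allFin; _++_; filter; length; foldr; concatMap)
open import Data.Bool using (Bool; true; false; not; _∧_; if_then_else_)
open import Data.Product using (_×_)

Σℕ : ∀ {k} → (Fin k → ℕ) → ℕ
Σℕ {k} f = foldr (λ i acc → f i ℕ.+ acc) 0 (allFin k)

Σℤ : ∀ {k} → (Fin k → ℤ) → ℤ
Σℤ {k} f = foldr (λ i acc → f i + acc) (+ 0) (allFin k)

count : ∀ {k} → (Fin k → Bool) → ℕ
count f = Σℕ (λ i → if f i then 1 else 0)

-- An instance of deadline scheduling with processor bounds.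
-- Time slots T = {0,…,d} are Fin (suc d); jobs are Fin n.
record Instance : Set where
  field
    m      : ℕ                      -- number of processors
    d      : ℕ                      -- last time slot
    n      : ℕ
    r      : Fin n → ℕ              -- release times
    dl     : Fin n → ℕ
    p      : Fin n → ℕ              -- processing volumes
    l      : Fin (ℕ.suc d) → ℕ
    mt     : Fin (ℕ.suc d) → ℕ
    l≤mt   : ∀ t → l t ≤ mt t
    mt≤m   : ∀ t → mt t ≤ m

module _ (I : Instance) where
  open Instance I

  Slot : Set
  Slot = Fin (ℕ.suc d)

  SlotSet : Set
  SlotSet = Slot → Bool

  inE : Fin n → Slot → Bool
  inE j t = (r j ≤ᵇ toℕ t) ∧ (toℕ t ≤ᵇ dl j)

  P : ℕ
  P = Σℕ p

  E∖Q : Fin n → SlotSet → ℕ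
  E∖Q j Q = count (λ t → inE j t ∧ not (Q t))

  E∩Q : Fin n → SlotSet → ℕ
  E∩Q j Q = count (λ t → inE j t ∧ Q t)

  fvJ : Fin n → SlotSet → ℕ
  fvJ j Q = p j ∸ E∖Q j Q

  pvJ : Fin n → SlotSet → ℕ
  pvJ j Q = p j ⊓ E∩Q j Q

  fv : SlotSet → ℕ
  fv Q = Σℕ (λ j → fvJ j Q)

  pv : SlotSet → ℕ
  pv Q = Σℕ (λ j → pvJ j Q)

  ΣQ : SlotSet → (Slot → ℕ) → ℕ
  ΣQ Q f = Σℕ (λ t → if Q t then f t else 0)

  def : SlotSet → ℤ
  def Q = + fv Q - + ΣQ Q mt

  exc : SlotSet → ℤ
  exc Q = + ΣQ Q l - + pv Q

  data Node : Set where
    α ω γ : Node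
    u : Fin n → Node
    v : Slot → Node

  nodes : List Node
  nodes = α ∷ ω ∷ γ ∷ (map u (allFin n) ++ map v (allFin (ℕ.suc d)))

  cap : Node → Node → ℤ
  cap α (u j) = + p j
  cap (u j) (v t) = if inE j t then + 1 else + 0
  cap (v t) γ = + (mt t ∸ l t)
  cap (v t) ω = + l t
  cap γ ω = + P - + Σℕ l
  cap _ _ = + 0

  NodeSet : Set
  NodeSet = Node → Bool

  cutCap : NodeSet → ℤ
  cutCap S = foldr _+_ (+ 0)
    (concatMap (λ x → map (λ y → if S x ∧ not (S y) then cap x y else + 0) nodes) nodes)

  QS : NodeSet → SlotSet
  QS S t = S (v t)

  QS̄ : NodeSet → SlotSet
  QS̄ S t = not (S (v t))

{-# OPTIONS --safe #-}
-- Split the cut into its job part (arcs α → u_j and u_j → v_t) and its slot part (arcs out of the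
-- v_t and out of γ).  For each job, either u_j ∉ S and the arc α → u_j of capacity p_j is cut, or
-- u_j ∈ S and every arc u_j → v_t with t ∈ E_j ∩ Q(S̄) is cut; either way the job contributes at
-- least min{p_j, |E_j ∩ Q(S̄)|}, so the job part is at least pv(Q(S̄)) = P − fv(Q(S)).
-- If γ ∉ S the slot part is Σ_{t ∈ Q(S)} m_t, giving P − def(Q(S)); if γ ∈ S it is
-- P − Σ_t l_t + Σ_{t ∈ Q(S)} l_t = P − Σ_{t ∈ Q(S̄)} l_t, giving P − exc(Q(S̄)).
module Submission where

open import Defs
open import Algebra.Bundles using (CommutativeMonoid)
import Algebra.Properties.CommutativeSemigroup as CommutativeSemigroupProperties
open import Level using (Level)
open import Data.Bool using (Bool; true; false; not; _∧_; if_then_else_)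
open import Data.Fin using (Fin)
open import Data.Integer using (ℤ; +_; _-_; _+_; _≤_; +≤+)
import Data.Integer.Properties as ℤP
open import Data.Integer.Tactic.RingSolver using (solve-∀)
open import Data.List using (List; []; _∷_; map; _++_; foldr; concatMap; allFin)
open import Data.List.Properties using (foldr-map)
open import Data.Nat as ℕ using (ℕ; _⊓_; _∸_)
import Data.Nat.Properties as ℕP
open import Data.Sum using (_⊎_; inj₁; inj₂)
open import Function using (_∘_)
open import Relation.Binary.PropositionalEquality using (_≡_; refl; sym; trans; cong; cong₂; module ≡-Reasoning)
open import Relation.Binary.Bundles using (Setoid)
import Relation.Binary.Reasoning.Setoid as SetoidReasoning

module ListSum {c ℓ} (M : CommutativeMonoid c ℓ) where
  open CommutativeMonoid M
    using (Carrier; _≈_; _∙_; ε; setoid; ∙-cong; ∙-congˡ; identityˡ; assoc; commutativeSemigroup)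
  open CommutativeSemigroupProperties commutativeSemigroup using (interchange)
  module ≈ = Setoid setoid
  open SetoidReasoning setoid

  private variable a : Level

  ∑ : {A : Set a} → List A → (A → Carrier) → Carrier
  ∑ xs f = foldr (λ x acc → f x ∙ acc) ε xs

  ∑-cong : {A : Set a} (xs : List A) {f g : A → Carrier} → (∀ x → f x ≈ g x) → ∑ xs f ≈ ∑ xs g
  ∑-cong []       f≈g = ≈.refl
  ∑-cong (x ∷ xs) f≈g = ∙-cong (f≈g x) (∑-cong xs f≈g)

  ∑-ε : {A : Set a} (xs : List A) {f : A → Carrier} → (∀ x → f x ≈ ε) → ∑ xs f ≈ ε
  ∑-ε []       f≈ε = ≈.refl
  ∑-ε (x ∷ xs) f≈ε = ≈.trans (∙-cong (f≈ε x) (∑-ε xs f≈ε)) (identityˡ ε)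

  ∑-distrib : {A : Set a} (xs : List A) (f g : A → Carrier) →
              ∑ xs (λ x → f x ∙ g x) ≈ ∑ xs f ∙ ∑ xs g
  ∑-distrib []       f g = ≈.sym (identityˡ ε)
  ∑-distrib (x ∷ xs) f g = begin
    (f x ∙ g x) ∙ ∑ xs (λ y → f y ∙ g y) ≈⟨ ∙-congˡ (∑-distrib xs f g) ⟩
    (f x ∙ g x) ∙ (∑ xs f ∙ ∑ xs g)     ≈⟨ interchange (f x) (g x) (∑ xs f) (∑ xs g) ⟩
    (f x ∙ ∑ xs f) ∙ (g x ∙ ∑ xs g)     ∎

  ∑-++ : {A : Set a} (xs ys : List A) (f : A → Carrier) → ∑ (xs ++ ys) f ≈ ∑ xs f ∙ ∑ ys f
  ∑-++ []       ys f = ≈.sym (identityˡ (∑ ys f))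
  ∑-++ (x ∷ xs) ys f = ≈.trans (∙-congˡ (∑-++ xs ys f)) (≈.sym (assoc (f x) (∑ xs f) (∑ ys f)))

  ∑-map : {A B : Set a} (g : A → B) (xs : List A) (f : B → Carrier) → ∑ (map g xs) f ≈ ∑ xs (f ∘ g)
  ∑-map g xs f = ≈.reflexive (foldr-map _ g ε xs)

  foldr-concatMap : {A : Set a} (F : A → List Carrier) (xs : List A) →
                    foldr _∙_ ε (concatMap F xs) ≈ ∑ xs (foldr _∙_ ε ∘ F)
  foldr-concatMap F []       = ≈.refl
  foldr-concatMap F (x ∷ xs) =
    ≈.trans (∑-++ (F x) (concatMap F xs) (λ z → z)) (∙-congˡ (foldr-concatMap F xs))

module ℕΣ = ListSum ℕP.+-0-commutativeMonoid
module ℤΣ = ListSum ℤP.+-0-commutativeMonoid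

∑-mono-≤ : {A : Set} (xs : List A) {f g : A → ℤ} → (∀ x → f x ≤ g x) → ℤΣ.∑ xs f ≤ ℤΣ.∑ xs g
∑-mono-≤ []       f≤g = ℤP.≤-refl
∑-mono-≤ (x ∷ xs) f≤g = ℤP.+-mono-≤ (f≤g x) (∑-mono-≤ xs f≤g)

pos-∑ : {A : Set} (xs : List A) (f : A → ℕ) → + ℕΣ.∑ xs f ≡ ℤΣ.∑ xs (λ x → + f x)
pos-∑ []       f = refl
pos-∑ (x ∷ xs) f = trans (ℤP.pos-+ (f x) _) (cong (_+_ (+ f x)) (pos-∑ xs f))

∁ : {A : Set} → (A → Bool) → A → Bool
∁ Q x = not (Q x)

module _ (I : Instance) where
  open Instance I
  open ≡-Reasoning

  pv-∁+fv≡P : (Q : SlotSet I) → pv I (∁ Q) ℕ.+ fv I Q ≡ P I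
  pv-∁+fv≡P Q = trans (sym (ℕΣ.∑-distrib (allFin n) (λ j → pvJ I j (∁ Q)) (λ j → fvJ I j Q)))
                      (ℕΣ.∑-cong (allFin n) min+monus)
    where
    min+monus : ∀ j → p j ⊓ E∖Q I j Q ℕ.+ (p j ∸ E∖Q I j Q) ≡ p j
    min+monus j = trans (cong (ℕ._+ (p j ∸ E∖Q I j Q)) (ℕP.⊓-comm (p j) (E∖Q I j Q)))
                        (ℕP.m⊓n+n∸m≡n (E∖Q I j Q) (p j))

  ΣQ+ΣQ-∁≡Σℕ : (Q : SlotSet I) (f : Slot I → ℕ) → ΣQ I Q f ℕ.+ ΣQ I (∁ Q) f ≡ Σℕ f
  ΣQ+ΣQ-∁≡Σℕ Q f = trans (sym (ℕΣ.∑-distrib (allFin (ℕ.suc d)) (λ t → if Q t then f t else 0)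
                                                              (λ t → if ∁ Q t then f t else 0)))
                         (ℕΣ.∑-cong (allFin (ℕ.suc d)) split)
    where
    split : ∀ t → (if Q t then f t else 0) ℕ.+ (if not (Q t) then f t else 0) ≡ f t
    split t with Q t
    ... | true  = ℕP.+-identityʳ (f t)
    ... | false = refl

  ∑-nodes : (F : Node I → ℤ) →
            ℤΣ.∑ (nodes I) F ≡ F α + (F ω + (F γ + (Σℤ (F ∘ u) + Σℤ (F ∘ v))))
  ∑-nodes F = cong (λ s → F α + (F ω + (F γ + s))) (begin
    ℤΣ.∑ (map u (allFin n) ++ map v (allFin (ℕ.suc d))) F
      ≡⟨ ℤΣ.∑-++ (map u (allFin n)) (map v (allFin (ℕ.suc d))) F ⟩
    ℤΣ.∑ (map u (allFin n)) F + ℤΣ.∑ (map v (allFin (ℕ.suc d))) F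
      ≡⟨ cong₂ _+_ (ℤΣ.∑-map u (allFin n) F) (ℤΣ.∑-map v (allFin (ℕ.suc d)) F) ⟩
    Σℤ (F ∘ u) + Σℤ (F ∘ v) ∎)

  -- No arc enters α, and in the left-nested sum the closed sums of + 0 left by absent arcs compute.
  ∑-nodes≡ : ∀ F {b c x y} →
             F α ≡ + 0 → F ω ≡ b → F γ ≡ c → Σℤ (F ∘ u) ≡ x → Σℤ (F ∘ v) ≡ y →
             ℤΣ.∑ (nodes I) F ≡ b + c + x + y
  ∑-nodes≡ F {b} {c} {x} {y} Fα Fω Fγ Fu Fv = begin
    ℤΣ.∑ (nodes I) F
      ≡⟨ ∑-nodes F ⟩
    F α + (F ω + (F γ + (Σℤ (F ∘ u) + Σℤ (F ∘ v))))
      ≡⟨ cong₂ _+_ Fα (cong₂ _+_ Fω (cong₂ _+_ Fγ (cong₂ _+_ Fu Fv))) ⟩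
    + 0 + (b + (c + (x + y)))
      ≡⟨ reassociate b c x y ⟩
    b + c + x + y ∎
    where
    reassociate : ∀ b c x y → + 0 + (b + (c + (x + y))) ≡ b + c + x + y
    reassociate = solve-∀

module CutCapacity (I : Instance) (S : NodeSet I) where
  open Instance I
  open ≡-Reasoning

  arc : Node I → Node I → ℤ
  arc x y = if S x ∧ not (S y) then cap I x y else + 0

  arc-absent : ∀ {x y} → cap I x y ≡ + 0 → arc x y ≡ + 0
  arc-absent {x} {y} noArc with S x ∧ not (S y)
  ... | true  = noArc
  ... | false = refl

  arcs-absent : ∀ x {k} (y : Fin k → Node I) → (∀ i → cap I x (y i) ≡ + 0) → Σℤ (arc x ∘ y) ≡ + 0
  arcs-absent x y noArcs = ℤΣ.∑-ε (allFin _) (λ i → arc-absent (noArcs i))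

  outflow : Node I → ℤ
  outflow x = ℤΣ.∑ (nodes I) (arc x)

  cutCap≡∑outflow : cutCap I S ≡ ℤΣ.∑ (nodes I) outflow
  cutCap≡∑outflow = trans (ℤΣ.foldr-concatMap (λ x → map (arc x) (nodes I)) (nodes I))
    (ℤΣ.∑-cong (nodes I) (λ x → ℤΣ.∑-map (arc x) (nodes I) (λ z → z)))

  outflow-α : outflow α ≡ Σℤ (λ j → arc α (u j))
  outflow-α = trans (∑-nodes≡ I (arc α) (arc-absent refl) (arc-absent refl) (arc-absent refl) refl
                                      (arcs-absent α v λ _ → refl))
                    (trans (ℤP.+-identityʳ _) (ℤP.+-identityˡ _))

  outflow-ω : outflow ω ≡ + 0
  outflow-ω = ∑-nodes≡ I (arc ω) (arc-absent refl) (arc-absent refl) (arc-absent refl)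
                               (arcs-absent ω u λ _ → refl) (arcs-absent ω v λ _ → refl)

  outflow-γ : outflow γ ≡ arc γ ω
  outflow-γ = trans (∑-nodes≡ I (arc γ) (arc-absent refl) refl (arc-absent refl)
                                      (arcs-absent γ u λ _ → refl) (arcs-absent γ v λ _ → refl))
                    (trans (ℤP.+-identityʳ _) (trans (ℤP.+-identityʳ _) (ℤP.+-identityʳ _)))

  outflow-u : ∀ j → outflow (u j) ≡ Σℤ (λ t → arc (u j) (v t))
  outflow-u j = trans (∑-nodes≡ I (arc (u j)) (arc-absent refl) (arc-absent refl) (arc-absent refl)
                                            (arcs-absent (u j) u λ _ → refl) refl)
                      (ℤP.+-identityˡ _)

  outflow-v : ∀ t → outflow (v t) ≡ arc (v t) ω + arc (v t) γ
  outflow-v t = trans (∑-nodes≡ I (arc (v t)) (arc-absent refl) refl refl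
                                            (arcs-absent (v t) u λ _ → refl) (arcs-absent (v t) v λ _ → refl))
                      (trans (ℤP.+-identityʳ _) (ℤP.+-identityʳ _))

  jobArcs : Fin n → ℤ
  jobArcs j = arc α (u j) + Σℤ (λ t → arc (u j) (v t))

  slotArcs : Slot I → ℤ
  slotArcs t = arc (v t) ω + arc (v t) γ

  cutCap-decomposition : cutCap I S ≡ Σℤ jobArcs + arc γ ω + Σℤ slotArcs
  cutCap-decomposition = begin
    cutCap I S
      ≡⟨ cutCap≡∑outflow ⟩
    ℤΣ.∑ (nodes I) outflow
      ≡⟨ ∑-nodes I outflow ⟩
    outflow α + (outflow ω + (outflow γ + (Σℤ (outflow ∘ u) + Σℤ (outflow ∘ v))))
      ≡⟨ cong₂ _+_ outflow-α (cong₂ _+_ outflow-ω (cong₂ _+_ outflow-γ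
           (cong₂ _+_ (ℤΣ.∑-cong (allFin n) outflow-u) (ℤΣ.∑-cong (allFin (ℕ.suc d)) outflow-v)))) ⟩
    A + (+ 0 + (arc γ ω + (R + Σℤ slotArcs)))
      ≡⟨ reorder A (arc γ ω) R (Σℤ slotArcs) ⟩
    A + R + arc γ ω + Σℤ slotArcs
      ≡⟨ cong (λ s → s + arc γ ω + Σℤ slotArcs)
              (ℤΣ.∑-distrib (allFin n) (λ j → arc α (u j)) (λ j → Σℤ (λ t → arc (u j) (v t)))) ⟨
    Σℤ jobArcs + arc γ ω + Σℤ slotArcs ∎
    where
    A R : ℤ
    A = Σℤ (λ j → arc α (u j))
    R = Σℤ (λ j → Σℤ (λ t → arc (u j) (v t)))
    reorder : ∀ a g r w → a + (+ 0 + (g + (r + w))) ≡ a + r + g + w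
    reorder = solve-∀

  -- E∖Q I j (QS I S) and E∩Q I j (QS̄ I S), the count occurring in pv (QS̄ I S), are the same term.
  jobArcs≡ : S α ≡ true → ∀ j → jobArcs j ≡ + (if S (u j) then E∖Q I j (QS I S) else p j)
  jobArcs≡ sα j rewrite sα with S (u j)
  ... | false = trans (cong (_+_ (+ p j)) (ℤΣ.∑-ε (allFin (ℕ.suc d)) λ _ → refl)) (ℤP.+-identityʳ _)
  ... | true  = trans (ℤP.+-identityˡ _)
                      (sym (trans (pos-∑ (allFin _) (λ t → if inE I j t ∧ not (S (v t)) then 1 else 0))
                                  (ℤΣ.∑-cong (allFin _) slotAfterJob)))
    where
    slotAfterJob : ∀ t → + (if inE I j t ∧ not (S (v t)) then 1 else 0)
                       ≡ (if not (S (v t)) then (if inE I j t then + 1 else + 0) else + 0)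
    slotAfterJob t with inE I j t | S (v t)
    ... | true  | true  = refl
    ... | true  | false = refl
    ... | false | true  = refl
    ... | false | false = refl

  pv[QS̄]≤∑jobArcs : S α ≡ true → + pv I (QS̄ I S) ≤ Σℤ jobArcs
  pv[QS̄]≤∑jobArcs sα =
    ℤP.≤-trans (ℤP.≤-reflexive (pos-∑ (allFin n) (λ j → pvJ I j (QS̄ I S))))
               (∑-mono-≤ (allFin n) λ j →
                  ℤP.≤-trans (min≤either (S (u j))) (ℤP.≤-reflexive (sym (jobArcs≡ sα j))))
    where
    min≤either : ∀ {j} b → + (p j ⊓ E∖Q I j (QS I S)) ≤ + (if b then E∖Q I j (QS I S) else p j)
    min≤either {j} true  = +≤+ (ℕP.m⊓n≤n (p j) _)
    min≤either {j} false = +≤+ (ℕP.m⊓n≤m (p j) _)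

  slotArcs-γ∉S : S ω ≡ false → S γ ≡ false → ∀ t → slotArcs t ≡ + (if S (v t) then mt t else 0)
  slotArcs-γ∉S sω sγ t rewrite sω | sγ with S (v t)
  ... | true  = trans (sym (ℤP.pos-+ (l t) _)) (cong +_ (ℕP.m+[n∸m]≡n (l≤mt t)))
  ... | false = refl

  slotArcs-γ∈S : S ω ≡ false → S γ ≡ true → ∀ t → slotArcs t ≡ + (if S (v t) then l t else 0)
  slotArcs-γ∈S sω sγ t rewrite sω | sγ with S (v t)
  ... | true  = ℤP.+-identityʳ _
  ... | false = refl

  arcγω-γ∉S : S γ ≡ false → arc γ ω ≡ + 0
  arcγω-γ∉S sγ rewrite sγ = refl

  arcγω-γ∈S : S ω ≡ false → S γ ≡ true → arc γ ω ≡ + P I - + Σℕ l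
  arcγω-γ∈S sω sγ rewrite sω | sγ = refl

module _ (I : Instance) (S : NodeSet I) where
  open Instance I
  open CutCapacity I S
  open ℤP.≤-Reasoning

  P≡pv[QS̄]+fv[QS] : + P I ≡ + pv I (QS̄ I S) + + fv I (QS I S)
  P≡pv[QS̄]+fv[QS] = trans (cong +_ (sym (pv-∁+fv≡P I (QS I S))))
                           (ℤP.pos-+ (pv I (QS̄ I S)) (fv I (QS I S)))

  P-def≤cutCap : S α ≡ true → S ω ≡ false → S γ ≡ false → + P I - def I (QS I S) ≤ cutCap I S
  P-def≤cutCap sα sω sγ = begin
    + P I - (+ fv I (QS I S) - + M)
      ≡⟨ cong (_- (+ fv I (QS I S) - + M)) P≡pv[QS̄]+fv[QS] ⟩
    + pv I (QS̄ I S) + + fv I (QS I S) - (+ fv I (QS I S) - + M)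
      ≡⟨ cancel (+ pv I (QS̄ I S)) (+ fv I (QS I S)) (+ M) ⟩
    + pv I (QS̄ I S) + + M
      ≤⟨ ℤP.+-monoˡ-≤ (+ M) (pv[QS̄]≤∑jobArcs sα) ⟩
    Σℤ jobArcs + + M
      ≡⟨ cong (λ s → s + + M) (ℤP.+-identityʳ (Σℤ jobArcs)) ⟨
    Σℤ jobArcs + + 0 + + M
      ≡⟨ cong₂ (λ g w → Σℤ jobArcs + g + w) (arcγω-γ∉S sγ) ∑slotArcs ⟨
    Σℤ jobArcs + arc γ ω + Σℤ slotArcs
      ≡⟨ cutCap-decomposition ⟨
    cutCap I S ∎
    where
    M : ℕ
    M = ΣQ I (QS I S) mt
    ∑slotArcs : Σℤ slotArcs ≡ + M
    ∑slotArcs = trans (ℤΣ.∑-cong (allFin _) (slotArcs-γ∉S sω sγ))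
                      (sym (pos-∑ (allFin _) (λ t → if S (v t) then mt t else 0)))
    cancel : ∀ a f m → a + f - (f - m) ≡ a + m
    cancel = solve-∀

  P-exc≤cutCap : S α ≡ true → S ω ≡ false → S γ ≡ true → + P I - exc I (QS̄ I S) ≤ cutCap I S
  P-exc≤cutCap sα sω sγ = begin
    + P I - (+ L₂ - + pv I (QS̄ I S))
      ≡⟨ regroup (+ P I) (+ pv I (QS̄ I S)) (+ L₁) (+ L₂) ⟩
    + pv I (QS̄ I S) + (+ P I - (+ L₁ + + L₂) + + L₁)
      ≡⟨ cong (λ s → + pv I (QS̄ I S) + (+ P I - s + + L₁)) Σl≡L₁+L₂ ⟨
    + pv I (QS̄ I S) + (+ P I - + Σℕ l + + L₁)
      ≤⟨ ℤP.+-monoˡ-≤ (+ P I - + Σℕ l + + L₁) (pv[QS̄]≤∑jobArcs sα) ⟩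
    Σℤ jobArcs + (+ P I - + Σℕ l + + L₁)
      ≡⟨ ℤP.+-assoc (Σℤ jobArcs) (+ P I - + Σℕ l) (+ L₁) ⟨
    Σℤ jobArcs + (+ P I - + Σℕ l) + + L₁
      ≡⟨ cong₂ (λ g w → Σℤ jobArcs + g + w) (arcγω-γ∈S sω sγ) ∑slotArcs ⟨
    Σℤ jobArcs + arc γ ω + Σℤ slotArcs
      ≡⟨ cutCap-decomposition ⟨
    cutCap I S ∎
    where
    L₁ L₂ : ℕ
    L₁ = ΣQ I (QS I S) l
    L₂ = ΣQ I (QS̄ I S) l
    Σl≡L₁+L₂ : + Σℕ l ≡ + L₁ + + L₂
    Σl≡L₁+L₂ = trans (cong +_ (sym (ΣQ+ΣQ-∁≡Σℕ I (QS I S) l))) (ℤP.pos-+ L₁ L₂)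
    ∑slotArcs : Σℤ slotArcs ≡ + L₁
    ∑slotArcs = trans (ℤΣ.∑-cong (allFin _) (slotArcs-γ∈S sω sγ))
                      (sym (pos-∑ (allFin _) (λ t → if S (v t) then l t else 0)))
    regroup : ∀ P′ pv′ l₁ l₂ → P′ - (l₂ - pv′) ≡ pv′ + (P′ - (l₁ + l₂) + l₁)
    regroup = solve-∀

lemma3 : (I : Instance) → (S : NodeSet I) → S (α {I}) ≡ true → S (ω {I}) ≡ false →
    (+ P I - def I (QS I S) ≤ cutCap I S) ⊎ (+ P I - exc I (QS̄ I S) ≤ cutCap I S)
lemma3 I S sα sω = caseOnγ (S (γ {I})) refl
  where
  caseOnγ : ∀ b → S (γ {I}) ≡ b →
            (+ P I - def I (QS I S) ≤ cutCap I S) ⊎ (+ P I - exc I (QS̄ I S) ≤ cutCap I S)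
  caseOnγ false sγ = inj₁ (P-def≤cutCap I S sα sω sγ)
  caseOnγ true  sγ = inj₂ (P-exc≤cutCap I S sα sω sγ)
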